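{- Let $S$ and $T$ be two disjoint cliques in a graph $F$. Suppose that there are two vertex-disjoint paths $P_1$ and $P_2$ in $F$ such that each has length at most $2$, has one end vertex in $S$ and the other end vertex in $T$, and has all its remaining vertices outside $S \cup T$. Then, for any integer $l$ with $7 \leq l \leq \min(2|S|-1, 2|T|-1)$, the number of cycles of length $l$ in $F$ is at least $(((l-1)/2-3)/e)^{l-6}$. -}

module Defs where

open import Data.Nat as ℕ using (ℕ; zero; suc; _!; _∸_; _^_; _*_; _/_)
open import Data.Nat.Properties using (_!≢0)
open import Data.Integer using (+_)
open import Data.Rational as ℚ using (ℚ; 0ℚ; 1ℚ)
open import Data.Bool using (Bool; true; false; _∧_; not)
open import Data.Fin using (Fin; zero; suc; inject₁; fromℕ; _≟_)
open import Data.Fin.Subset using (Subset; _∈_; _∉_)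
open import Data.Vec using (Vec; []; _∷_; lookup)
open import Data.List as List using (List; []; _∷_; [_]; _++_; concatMap; map; allFin; length; filterᵇ)
open import Data.Bool.ListAction using (any)
open import Data.Product using (_×_; ∃)
open import Relation.Binary.PropositionalEquality using (_≡_; _≢_)
open import Relation.Nullary using (¬_; does)

record Graph (n : ℕ) : Set where
  field
    adj    : Fin n → Fin n → Bool
    sym    : ∀ x y → adj x y ≡ adj y x
    irrefl : ∀ x → ¬ (adj x x ≡ true)

module _ {n : ℕ} (F : Graph n) where
  open Graph F

  Edge : Fin n → Fin n → Set
  Edge x y = adj x y ≡ true

  IsClique : Subset n → Set
  IsClique S = ∀ x y → x ∈ S → y ∈ S → x ≢ y → Edge x y

  -- A path with k edges, given by its k+1 vertices (distinct, consecutive adjacent).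
  IsPath : ∀ {k} → Vec (Fin n) (suc k) → Set
  IsPath {k} P = (∀ i j → lookup P i ≡ lookup P j → i ≡ j)
               × (∀ (i : Fin k) → Edge (lookup P (inject₁ i)) (lookup P (suc i)))

  IsSTPath : ∀ {k} → Subset n → Subset n → Vec (Fin n) (suc k) → Set
  IsSTPath {k} S T P = IsPath P
    × lookup P zero ∈ S
    × lookup P (fromℕ k) ∈ T
    × (∀ i → i ≢ zero → i ≢ fromℕ k → lookup P i ∉ S × lookup P i ∉ T)

  allLists : ℕ → List (List (Fin n))
  allLists zero = [ [] ]
  allLists (suc l) = concatMap (λ v → map (_∷ v) (allFin n)) (allLists l)

  distinctB : List (Fin n) → Bool
  distinctB [] = true
  distinctB (x ∷ xs) = not (any (λ y → does (x ≟ y)) xs) ∧ distinctB xs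

  chainB : List (Fin n) → Bool
  chainB (x ∷ y ∷ r) = adj x y ∧ chainB (y ∷ r)
  chainB _ = true

  cyclicSeqB : List (Fin n) → Bool
  cyclicSeqB [] = false
  cyclicSeqB (x ∷ xs) = distinctB (x ∷ xs) ∧ chainB ((x ∷ xs) ++ [ x ])

  cyclicSeqCount : ℕ → ℕ
  cyclicSeqCount l = length (filterᵇ cyclicSeqB (allLists l))

  -- number of cycles of length l (for l ≥ 3, each cycle ↔ 2l cyclic sequences:
  -- l starting points × 2 directions)
  numCycles : ℕ → ℕ
  numCycles zero = 0
  numCycles (suc m) = cyclicSeqCount (suc m) / (2 * suc m)

expPartial : ℕ → ℕ → ℚ
expPartial k zero = 0ℚ
expPartial k (suc m) = expPartial k m ℚ.+ ((+ (k ^ m)) ℚ./ (m !)) {{m !≢0}}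

powℚ : ℚ → ℕ → ℚ
powℚ q zero = 1ℚ
powℚ q (suc k) = q ℚ.* powℚ q k

-- q ≤ N·e^k, with e^k = sup_m expPartial k m (real-number inequality
-- expressed via the supremum: for every rational ε > 0 some partial sum gets within ε).
_≤[_·e^_] : ℚ → ℕ → ℕ → Set
q ≤[ N ·e^ k ] = ∀ (ε : ℚ) → 0ℚ ℚ.< ε →
  ∃ λ m → q ℚ.< (((+ N) ℚ./ 1) ℚ.* expPartial k m) ℚ.+ ε

{-# OPTIONS --safe #-}
module Submission where

-- Walk along P₁ from S to T, through rT further vertices of the clique T, back along P₂ and
-- through rS further vertices of the clique S.  Every pair of orderings of these extra vertices
-- closes up into a cycle with l = |P₁| + |P₂| + rS + rT vertices, distinct pairs give distinct
-- cycles, and each cycle accounts for 2l cyclic sequences, so the number N of cycles of length l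
-- is at least rS! rT!.  As |P₁| + |P₂| ≤ 6, the bound on l leaves room for rS + rT ≥ l − 6, and then
-- (x + y)! ≤ x! y! 2^(x+y) and the growth of n!/2ⁿ give (l − 6)! ≤ N 2^(l−6).  Finally
-- kᵏ/k! ≤ eᵏ turns this into ((k − 1)/2)ᵏ ≤ N eᵏ for k = l − 6.

open import Defs

open import Level using (Level; _⊔_)
open import Function using (_∘_)
open import Data.Empty using (⊥; ⊥-elim)
open import Data.Unit using (tt)
open import Data.Bool.Base using (true; false; T; _∧_)
import Data.Bool.Base as Bool
open import Data.Bool.ListAction using (any)
open import Relation.Nullary using (¬_; does; yes; no)
open import Relation.Nullary.Decidable using (T?)
open import Data.Product using (Σ; _×_; _,_; proj₁; proj₂; ∃; ∃₂; uncurry)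
open import Data.Sum using (inj₁; inj₂)
open import Data.Nat.Base using (NonZero; ℕ; zero; suc; _+_; _*_; _^_; _⊓_; _≤_; _<_; _≤′_; ≤′-refl; ≤′-step; _∸_; _!; z≤n; s≤s; s≤s⁻¹)
import Data.Nat.DivMod as ℕ
open import Data.Nat.Tactic.RingSolver using (solve-∀)
import Data.Nat.Properties as ℕ
open import Data.Nat.Properties using (_!≢0)
open import Data.List.Base using (List; []; _∷_; [_]; _++_; reverse; length; take; drop)
import Data.List.Properties as List
import Data.List.Base as List
open import Data.List.Relation.Unary.All using (All; []; _∷_)
import Data.List.Relation.Unary.All as All
import Data.List.Relation.Unary.All.Properties as All
open import Data.List.Relation.Unary.Any as Any using (here; there)
import Data.List.Relation.Unary.Any.Properties as Any
open import Data.List.Relation.Unary.Linked using (Linked; []; [-]; _∷_)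
open import Data.List.Relation.Unary.AllPairs using ([]; _∷_)
open import Data.List.Relation.Unary.Unique.Propositional using (Unique)
import Data.List.Relation.Unary.Unique.Propositional.Properties as Unique
import Data.List.Relation.Binary.Permutation.Setoid.Properties as PermutationₛProperties
open import Data.List.Relation.Binary.Permutation.Propositional using (_↭_; ↭-sym; ↭-prep; ↭⇒↭ₛ)
import Data.List.Relation.Binary.Permutation.Propositional.Properties as Permutation
open import Data.List.Relation.Binary.Disjoint.Propositional using (Disjoint)
open import Data.List.Membership.Propositional using (_∈_; _∉_)
open import Data.List.Membership.Propositional.Properties using (∈-++⁻; ∈-++⁺ʳ; ∈-map⁺; ∈-concatMap⁺; ∈-filter⁺; ∈-allFin)
open import Data.Fin.Base as Fin using (Fin; zero; suc; toℕ; inject₁; inject≤; remQuot; combine; punchIn)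
import Data.Fin.Properties as Fin
open import Data.Fin.Subset as Subset using (Subset; inside; outside; ∣_∣; _─_; _-_; ⁅_⁆)
import Data.Fin.Subset.Properties as Subset
open import Data.Integer.Base using (+_)
import Data.Integer.Base as ℤ
import Data.Integer.Properties as ℤ
open import Data.Rational.Base using (0ℚ; _/_; toℚᵘ)
import Data.Rational.Base as ℚ
import Data.Rational.Properties as ℚ
open import Data.Rational.Unnormalised.Base using (mkℚᵘ)
import Data.Rational.Unnormalised.Base as ℚᵘ
import Data.Rational.Unnormalised.Properties as ℚᵘ
open import Data.Vec.Base as Vec using (Vec; []; _∷_; toList; lookup)
import Data.Vec.Properties as Vec
open import Function.Definitions using (Injective)
open import Relation.Binary.Core using (Rel)
open import Relation.Binary.Definitions using (Symmetric)
open import Relation.Binary.PropositionalEquality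
  using (_≡_; _≢_; refl; sym; trans; cong; cong₂; subst; subst₂; setoid; module ≡-Reasoning)

private
  variable
    a ℓ : Level

module _ {A : Set a} where

  ∉-++-∷-injective : ∀ {x : A} as as′ {bs bs′} → x ∉ as → x ∉ as′ →
                     as ++ x ∷ bs ≡ as′ ++ x ∷ bs′ → as ≡ as′ × bs ≡ bs′
  ∉-++-∷-injective []       []        _    _     refl = refl , refl
  ∉-++-∷-injective []       (_ ∷ _)   _    x∉as′ eq   = ⊥-elim (x∉as′ (here (List.∷-injectiveˡ eq)))
  ∉-++-∷-injective (_ ∷ _)  []        x∉as _     eq   = ⊥-elim (x∉as (here (sym (List.∷-injectiveˡ eq))))
  ∉-++-∷-injective (z ∷ as) (_ ∷ as′) x∉as x∉as′ eq
    with refl ← List.∷-injectiveˡ eq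
    with as≡as′ , bs≡bs′ ← ∉-++-∷-injective as as′ (x∉as ∘ there) (x∉as′ ∘ there) (List.∷-injectiveʳ eq)
    = cong (z ∷_) as≡as′ , bs≡bs′

  ++-injective-length : ∀ (as as′ : List A) {bs bs′} → length as ≡ length as′ →
                        as ++ bs ≡ as′ ++ bs′ → as ≡ as′ × bs ≡ bs′
  ++-injective-length []       []        _   eq = refl , eq
  ++-injective-length (z ∷ as) (_ ∷ as′) len eq
    with refl ← List.∷-injectiveˡ eq
    with as≡as′ , bs≡bs′ ← ++-injective-length as as′ (ℕ.suc-injective len) (List.∷-injectiveʳ eq)
    = cong (z ∷_) as≡as′ , bs≡bs′

  head-++-∷ : ∀ {P : A → Set ℓ} {as y bs} → All P as → P y →
              ∃₂ λ w cs → as ++ y ∷ bs ≡ w ∷ cs × P w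
  head-++-∷ {as = []}    []       Py = _ , _ , refl , Py
  head-++-∷ {as = _ ∷ _} (Pa ∷ _) _  = _ , _ , refl , Pa

  reverse-∷-++-[] : ∀ (x : A) as y → reverse (x ∷ as ++ [ y ]) ≡ y ∷ reverse as ++ [ x ]
  reverse-∷-++-[] x as y = begin
    reverse (x ∷ as ++ [ y ])     ≡⟨ List.unfold-reverse x (as ++ [ y ]) ⟩
    reverse (as ++ [ y ]) ++ [ x ] ≡⟨ cong (_++ [ x ]) (List.reverse-++ as [ y ]) ⟩
    y ∷ reverse as ++ [ x ]       ∎
    where open ≡-Reasoning

  reverse-++-reverse-++ : ∀ (as bs cs ds : List A) →
                          reverse (as ++ bs ++ reverse cs ++ ds) ≡ reverse ds ++ cs ++ reverse bs ++ reverse as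
  reverse-++-reverse-++ as bs cs ds = begin
    reverse (as ++ bs ++ reverse cs ++ ds)
      ≡⟨ List.reverse-++ as _ ⟩
    reverse (bs ++ reverse cs ++ ds) ++ reverse as
      ≡⟨ cong (_++ reverse as) (List.reverse-++ bs _) ⟩
    (reverse (reverse cs ++ ds) ++ reverse bs) ++ reverse as
      ≡⟨ cong (λ zs → (zs ++ reverse bs) ++ reverse as) (List.reverse-++ (reverse cs) ds) ⟩
    ((reverse ds ++ reverse (reverse cs)) ++ reverse bs) ++ reverse as
      ≡⟨ cong (λ zs → ((reverse ds ++ zs) ++ reverse bs) ++ reverse as) (List.reverse-involutive cs) ⟩
    ((reverse ds ++ cs) ++ reverse bs) ++ reverse as
      ≡⟨ List.++-assoc (reverse ds ++ cs) (reverse bs) (reverse as) ⟩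
    (reverse ds ++ cs) ++ reverse bs ++ reverse as
      ≡⟨ List.++-assoc (reverse ds) cs _ ⟩
    reverse ds ++ cs ++ reverse bs ++ reverse as
      ∎
    where open ≡-Reasoning

  ++-assoc₄ : ∀ (as bs cs ds es : List A) → (as ++ bs ++ cs ++ ds) ++ es ≡ as ++ bs ++ cs ++ ds ++ es
  ++-assoc₄ as bs cs ds es = begin
    (as ++ bs ++ cs ++ ds) ++ es ≡⟨ List.++-assoc as _ es ⟩
    as ++ (bs ++ cs ++ ds) ++ es ≡⟨ cong (as ++_) (List.++-assoc bs _ es) ⟩
    as ++ bs ++ (cs ++ ds) ++ es ≡⟨ cong (λ zs → as ++ bs ++ zs) (List.++-assoc cs ds es) ⟩
    as ++ bs ++ cs ++ ds ++ es   ∎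
    where open ≡-Reasoning

  Unique-resp-↭ : ∀ {xs ys : List A} → xs ↭ ys → Unique xs → Unique ys
  Unique-resp-↭ xs↭ys = PermutationₛProperties.Unique-resp-↭ (setoid A) (↭⇒↭ₛ xs↭ys)

  Unique-reverse : ∀ {xs : List A} → Unique xs → Unique (reverse xs)
  Unique-reverse {xs} = Unique-resp-↭ (↭-sym (Permutation.↭-reverse xs))

  Unique-++-comm : ∀ (xs : List A) {ys} → Unique (xs ++ ys) → Unique (ys ++ xs)
  Unique-++-comm xs {ys} = Unique-resp-↭ (Permutation.++-comm xs ys)

  Unique-∷-++-[] : ∀ {x y : A} {xs} → x ≢ y → x ∉ xs → y ∉ xs → Unique xs → Unique (x ∷ xs ++ [ y ])
  Unique-∷-++-[] {xs = xs} x≢y x∉xs y∉xs unique =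
    All.++⁺ (All.¬Any⇒All¬ xs x∉xs) (x≢y ∷ []) ∷ Unique.++⁺ unique ([] ∷ []) λ { (v∈xs , here refl) → y∉xs v∈xs }

module _ {A : Set a} {R : Rel A ℓ} where

  Linked-++-∷ : ∀ as {y bs} → Linked R (as ++ [ y ]) → Linked R (y ∷ bs) → Linked R (as ++ y ∷ bs)
  Linked-++-∷ []           _            R[y∷bs] = R[y∷bs]
  Linked-++-∷ (_ ∷ [])     (Ray ∷ [-])  R[y∷bs] = Ray ∷ R[y∷bs]
  Linked-++-∷ (_ ∷ _ ∷ as) (Raa′ ∷ Ras) R[y∷bs] = Raa′ ∷ Linked-++-∷ (_ ∷ as) Ras R[y∷bs]

  Linked-++-∷⁻ : ∀ as {y bs} → Linked R (as ++ y ∷ bs) → Linked R (as ++ [ y ]) × Linked R (y ∷ bs)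
  Linked-++-∷⁻ []           R[y∷bs]      = [-] , R[y∷bs]
  Linked-++-∷⁻ (_ ∷ [])     (Ray ∷ Rbs)  = Ray ∷ [-] , Rbs
  Linked-++-∷⁻ (_ ∷ _ ∷ as) (Raa′ ∷ Rs)
    with Ras , Rbs ← Linked-++-∷⁻ (_ ∷ as) Rs = Raa′ ∷ Ras , Rbs

  Linked-reverse : Symmetric R → ∀ {xs} → Linked R xs → Linked R (reverse xs)
  Linked-reverse sym-R []  = []
  Linked-reverse sym-R [-] = [-]
  Linked-reverse sym-R {x ∷ y ∷ xs} (Rxy ∷ Rys) =
    subst (Linked R) (sym reverse-x∷y∷xs)
      (Linked-++-∷ (reverse xs) (subst (Linked R) (List.unfold-reverse y xs) (Linked-reverse sym-R Rys))
                   (sym-R Rxy ∷ [-]))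
    where
    reverse-x∷y∷xs : reverse (x ∷ y ∷ xs) ≡ reverse xs ++ y ∷ [ x ]
    reverse-x∷y∷xs = begin
      reverse (x ∷ y ∷ xs)           ≡⟨ List.unfold-reverse x (y ∷ xs) ⟩
      reverse (y ∷ xs) ++ [ x ]      ≡⟨ cong (_++ [ x ]) (List.unfold-reverse y xs) ⟩
      (reverse xs ++ [ y ]) ++ [ x ] ≡⟨ List.++-assoc (reverse xs) [ y ] [ x ] ⟩
      reverse xs ++ y ∷ [ x ]        ∎
      where open ≡-Reasoning

module _ {A : Set a} where

  Injective⇒≤length : ∀ {m} {xs : List A} (g : Fin m → A) → Injective _≡_ _≡_ g → (∀ i → g i ∈ xs) → m ≤ length xs
  Injective⇒≤length {xs = xs} g g-inj g∈xs = Fin.injective⇒≤ {f = λ i → Any.index (g∈xs i)} λ {i} {j} eq →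
    g-inj (trans (Any.lookup-index (g∈xs i)) (trans (cong (List.lookup xs) eq) (sym (Any.lookup-index (g∈xs j)))))

  rotate : ℕ → A → List A → List A
  rotate j x V = drop j V ++ x ∷ take j V

  rotate-injective : ∀ {x : A} {V V′} j j′ → x ∉ V → x ∉ V′ → j ≤ length V → j′ ≤ length V′ →
                     rotate j x V ≡ rotate j′ x V′ → j ≡ j′ × V ≡ V′
  rotate-injective {x} {V} {V′} j j′ x∉V x∉V′ j≤∣V∣ j′≤∣V′∣ eq = j≡j′ , V≡V′
    where
    ∉-drop : ∀ k W → x ∉ W → x ∉ drop k W
    ∉-drop k W x∉W x∈ = x∉W (subst (x ∈_) (List.take++drop≡id k W) (∈-++⁺ʳ (take k W) x∈))

    length-take : ∀ k W → k ≤ length W → length (take k W) ≡ k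
    length-take k W k≤∣W∣ = trans (List.length-take k W) (ℕ.m≤n⇒m⊓n≡m k≤∣W∣)

    drops×takes : drop j V ≡ drop j′ V′ × take j V ≡ take j′ V′
    drops×takes = ∉-++-∷-injective (drop j V) (drop j′ V′) (∉-drop j V x∉V) (∉-drop j′ V′ x∉V′) eq

    j≡j′ : j ≡ j′
    j≡j′ = trans (sym (length-take j V j≤∣V∣)) (trans (cong length (proj₂ drops×takes)) (length-take j′ V′ j′≤∣V′∣))

    V≡V′ : V ≡ V′
    V≡V′ = begin
      V                        ≡⟨ List.take++drop≡id j V ⟨
      take j V ++ drop j V     ≡⟨ cong₂ _++_ (proj₂ drops×takes) (proj₁ drops×takes) ⟩
      take j′ V′ ++ drop j′ V′ ≡⟨ List.take++drop≡id j′ V′ ⟩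
      V′                       ∎
      where open ≡-Reasoning

  length-rotate : ∀ j (x : A) V → length (rotate j x V) ≡ suc (length V)
  length-rotate j x V = begin
    length (drop j V ++ x ∷ take j V)        ≡⟨ List.length-++ (drop j V) ⟩
    length (drop j V) + suc (length (take j V)) ≡⟨ ℕ.+-suc _ _ ⟩
    suc (length (drop j V) + length (take j V)) ≡⟨ cong suc (ℕ.+-comm (length (drop j V)) _) ⟩
    suc (length (take j V) + length (drop j V)) ≡⟨ cong suc (List.length-++ (take j V)) ⟨
    suc (length (take j V ++ drop j V))      ≡⟨ cong (suc ∘ length) (List.take++drop≡id j V) ⟩
    suc (length V)                           ∎
    where open ≡-Reasoning

  StartsWith : (A → Set ℓ) → List A → Set (a ⊔ ℓ)
  StartsWith P xs = ∃₂ λ w ws → xs ≡ w ∷ ws × P w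

  oriented : Fin 2 → List A → List A
  oriented zero       V = V
  oriented (suc zero) V = reverse V

  oriented-injective : ∀ {P : A → Set ℓ} {V V′} d d′ →
                       StartsWith (¬_ ∘ P) V → StartsWith (¬_ ∘ P) V′ → StartsWith P (reverse V) → StartsWith P (reverse V′) →
                       oriented d V ≡ oriented d′ V′ → d ≡ d′ × V ≡ V′
  oriented-injective zero       zero       _ _ _ _ eq = refl , eq
  oriented-injective (suc zero) (suc zero) _ _ _ _ eq = refl , List.reverse-injective eq
  oriented-injective zero       (suc zero) (w , _ , V≡w∷ , ¬Pw) _ _ (w′ , _ , V′ʳ≡w′∷ , Pw′) eq =
    ⊥-elim (¬Pw (subst _ (List.∷-injectiveˡ (trans (sym V′ʳ≡w′∷) (trans (sym eq) V≡w∷))) Pw′))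
  oriented-injective (suc zero) zero       _ (w , _ , V′≡w∷ , ¬Pw) (w′ , _ , Vʳ≡w′∷ , Pw′) _ eq =
    ⊥-elim (¬Pw (subst _ (List.∷-injectiveˡ (trans (sym Vʳ≡w′∷) (trans eq V′≡w∷))) Pw′))

  length-oriented : ∀ d V → length (oriented d V) ≡ length V
  length-oriented zero       V = refl
  length-oriented (suc zero) V = List.length-reverse V

  ∉-oriented : ∀ {x} d {V} → x ∉ V → x ∉ oriented d V
  ∉-oriented zero       x∉V = x∉V
  ∉-oriented (suc zero) x∉V = x∉V ∘ Any.reverse⁻

module _ {A : Set a} where

  ∈-toList⇒lookup : ∀ {k} {P : Vec A k} {y} → y ∈ toList P → ∃ λ i → lookup P i ≡ y
  ∈-toList⇒lookup {P = _ ∷ _} (here refl) = zero , refl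
  ∈-toList⇒lookup {P = _ ∷ _} (there y∈P) with i , Pᵢ≡y ← ∈-toList⇒lookup y∈P = suc i , Pᵢ≡y

  toList-Unique : ∀ {k} (P : Vec A k) → Injective _≡_ _≡_ (lookup P) → Unique (toList P)
  toList-Unique []      _     = []
  toList-Unique (x ∷ P) P-inj =
    All.tabulate (λ y∈P x≡y → let i , Pᵢ≡y = ∈-toList⇒lookup y∈P in
                               Fin.0≢1+n (P-inj (trans x≡y (sym Pᵢ≡y))))
    ∷ toList-Unique P (Fin.suc-injective ∘ P-inj)

  toList-Linked : ∀ {R : Rel A ℓ} {k} (P : Vec A (suc k)) →
                  (∀ (i : Fin k) → R (lookup P (inject₁ i)) (lookup P (suc i))) → Linked R (toList P)
  toList-Linked (_ ∷ [])    _      = [-]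
  toList-Linked (_ ∷ _ ∷ P) R-step = R-step zero ∷ toList-Linked (_ ∷ P) (R-step ∘ suc)

  toList-Disjoint : ∀ {k k′} (P : Vec A k) (P′ : Vec A k′) → (∀ i j → lookup P i ≢ lookup P′ j) →
                    Disjoint (toList P) (toList P′)
  toList-Disjoint P P′ P#P′ (y∈P , y∈P′)
    with i , Pᵢ≡y ← ∈-toList⇒lookup y∈P | j , P′ⱼ≡y ← ∈-toList⇒lookup y∈P′
    = P#P′ i j (trans Pᵢ≡y (sym P′ⱼ≡y))

remQuot-injective : ∀ {m} k {i j : Fin (m * k)} → remQuot {m} k i ≡ remQuot k j → i ≡ j
remQuot-injective {m} k {i} {j} eq = begin
  i                                 ≡⟨ Fin.combine-remQuot {m} k i ⟨
  uncurry combine (remQuot {m} k i) ≡⟨ cong (uncurry combine) eq ⟩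
  uncurry combine (remQuot {m} k j) ≡⟨ Fin.combine-remQuot {m} k j ⟩
  j                                 ∎
  where open ≡-Reasoning

flatten : ∀ {b} {B : Set b} {m k} → (Fin m → Fin k → B) → Fin (m * k) → B
flatten {k = k} f = uncurry f ∘ remQuot k

flatten-∀ : ∀ {b} {B : Set b} {P : B → Set ℓ} {m k} {f : Fin m → Fin k → B} →
            (∀ i j → P (f i j)) → ∀ x → P (flatten f x)
flatten-∀ {k = k} Pf = uncurry Pf ∘ remQuot k

flatten-injective : ∀ {b} {B : Set b} {m k} {f : Fin m → Fin k → B} →
                    (∀ {i j i′ j′} → f i j ≡ f i′ j′ → i ≡ i′ × j ≡ j′) → Injective _≡_ _≡_ (flatten f)
flatten-injective {k = k} f-inj eq with i≡i′ , j≡j′ ← f-inj eq = remQuot-injective k (cong₂ _,_ i≡i′ j≡j′)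

module _ {A : Set a} where

  arrangement : ∀ {m} → (Fin m → A) → Fin (m !) → List A
  arrangement {zero}  v _ = []
  arrangement {suc m} v σ with i , σ′ ← remQuot {suc m} (m !) σ = v i ∷ arrangement (v ∘ punchIn i) σ′

  length-arrangement : ∀ {m} (v : Fin m → A) σ → length (arrangement v σ) ≡ m
  length-arrangement {zero}  v σ = refl
  length-arrangement {suc m} v σ = cong suc (length-arrangement _ _)

  ∈-arrangement⁻ : ∀ {m} (v : Fin m → A) σ {x} → x ∈ arrangement v σ → ∃ λ j → v j ≡ x
  ∈-arrangement⁻ {suc m} v σ (here refl) = _ , refl
  ∈-arrangement⁻ {suc m} v σ (there x∈) with j , vⱼ≡x ← ∈-arrangement⁻ _ _ x∈ = _ , vⱼ≡x

  arrangement-Unique : ∀ {m} {v : Fin m → A} → Injective _≡_ _≡_ v → ∀ σ → Unique (arrangement v σ)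
  arrangement-Unique {zero}          v-inj σ = []
  arrangement-Unique {suc m} {v = v} v-inj σ =
    All.tabulate (λ x∈ vᵢ≡x → let j , vⱼ≡x = ∈-arrangement⁻ _ _ x∈ in
                              Fin.punchInᵢ≢i i j (v-inj (trans vⱼ≡x (sym vᵢ≡x))))
    ∷ arrangement-Unique (Fin.punchIn-injective i _ _ ∘ v-inj) _
    where i = proj₁ (remQuot {suc m} (m !) σ)

  arrangement-injective : ∀ {m} {v : Fin m → A} → Injective _≡_ _≡_ v → Injective _≡_ _≡_ (arrangement v)
  arrangement-injective {zero} v-inj {zero} {zero} _ = refl
  arrangement-injective {suc m} {v = v} v-inj {σ} {τ} eq
    with i≡j ← v-inj (List.∷-injectiveˡ eq) = remQuot-injective (m !) (cong₂ _,_ i≡j (tails-equal i≡j (List.∷-injectiveʳ eq)))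
    where
    tails-equal : ∀ {i j σ′ τ′} → i ≡ j → arrangement (v ∘ punchIn i) σ′ ≡ arrangement (v ∘ punchIn j) τ′ → σ′ ≡ τ′
    tails-equal {i} refl = arrangement-injective (Fin.punchIn-injective i _ _ ∘ v-inj)

enumerate : ∀ {n} (p : Subset n) → Fin ∣ p ∣ → Fin n
enumerate (inside  ∷ p) zero    = zero
enumerate (inside  ∷ p) (suc i) = suc (enumerate p i)
enumerate (outside ∷ p) i       = suc (enumerate p i)

enumerate-∈ : ∀ {n} (p : Subset n) i → enumerate p i Subset.∈ p
enumerate-∈ (inside  ∷ p) zero    = Vec.here
enumerate-∈ (inside  ∷ p) (suc i) = Vec.there (enumerate-∈ p i)
enumerate-∈ (outside ∷ p) i       = Vec.there (enumerate-∈ p i)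

enumerate-injective : ∀ {n} (p : Subset n) → Injective _≡_ _≡_ (enumerate p)
enumerate-injective (inside  ∷ p) {zero}  {zero}  _  = refl
enumerate-injective (inside  ∷ p) {suc i} {suc j} eq = cong suc (enumerate-injective p (Fin.suc-injective eq))
enumerate-injective (outside ∷ p)                 eq = enumerate-injective p (Fin.suc-injective eq)

∣p∣≤∣p─q∣+∣q∣ : ∀ {n} (p q : Subset n) → ∣ p ∣ ≤ ∣ p ─ q ∣ + ∣ q ∣
∣p∣≤∣p─q∣+∣q∣ []            []            = z≤n
∣p∣≤∣p─q∣+∣q∣ (inside  ∷ p) (outside ∷ q) = s≤s (∣p∣≤∣p─q∣+∣q∣ p q)
∣p∣≤∣p─q∣+∣q∣ (outside ∷ p) (outside ∷ q) = ∣p∣≤∣p─q∣+∣q∣ p q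
∣p∣≤∣p─q∣+∣q∣ (inside  ∷ p) (inside  ∷ q) =
  ℕ.≤-trans (s≤s (∣p∣≤∣p─q∣+∣q∣ p q)) (ℕ.≤-reflexive (sym (ℕ.+-suc _ _)))
∣p∣≤∣p─q∣+∣q∣ (outside ∷ p) (inside  ∷ q) =
  ℕ.≤-trans (∣p∣≤∣p─q∣+∣q∣ p q) (ℕ.+-monoʳ-≤ _ (ℕ.n≤1+n _))

∣p∣≤1+∣p-x∣ : ∀ {n} (p : Subset n) x → ∣ p ∣ ≤ suc ∣ p - x ∣
∣p∣≤1+∣p-x∣ p x = ℕ.≤-trans (∣p∣≤∣p─q∣+∣q∣ p ⁅ x ⁆)
  (ℕ.≤-reflexive (trans (cong (_+_ ∣ p - x ∣) (Subset.∣⁅x⁆∣≡1 x)) (ℕ.+-comm _ 1)))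

∣p∣∸2≤∣p-x-y∣ : ∀ {n} (p : Subset n) x y → ∣ p ∣ ∸ 2 ≤ ∣ p - x - y ∣
∣p∣∸2≤∣p-x-y∣ p x y = ℕ.m≤n+o⇒m∸n≤o ∣ p ∣ 2 (ℕ.≤-trans (∣p∣≤1+∣p-x∣ p x) (s≤s (∣p∣≤1+∣p-x∣ (p - x) y)))

x∈p-y⇒x≢y : ∀ {n} {p : Subset n} {x y} → x Subset.∈ p - y → x ≢ y
x∈p-y⇒x≢y {p = _ ∷ _} {x = zero}  {y = zero}  ()
x∈p-y⇒x≢y             {x = zero}  {y = suc _} _              ()
x∈p-y⇒x≢y             {x = suc _} {y = zero}  _              ()
x∈p-y⇒x≢y {p = _ ∷ _} {x = suc _} {y = suc _} (Vec.there x∈) refl = x∈p-y⇒x≢y x∈ refl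

∈p-x-y⁻ : ∀ {n} {p : Subset n} {v x y} → v Subset.∈ p - x - y → v Subset.∈ p × v ≢ x × v ≢ y
∈p-x-y⁻ {p = p} {x = x} {y} v∈ =
  Subset.p─q⊆p p ⁅ x ⁆ (Subset.p─q⊆p (p - x) ⁅ y ⁆ v∈) ,
  x∈p-y⇒x≢y (Subset.p─q⊆p (p - x) ⁅ y ⁆ v∈) ,
  x∈p-y⇒x≢y v∈

module Orderings {n} (p : Subset n) (x y : Fin n) {m} (m≤∣p-x-y∣ : m ≤ ∣ p - x - y ∣) where

  element : Fin m → Fin n
  element i = enumerate (p - x - y) (inject≤ i m≤∣p-x-y∣)

  element-injective : Injective _≡_ _≡_ element
  element-injective eq = Fin.inject≤-injective m≤∣p-x-y∣ m≤∣p-x-y∣ _ _ (enumerate-injective (p - x - y) eq)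

  ordering : Fin (m !) → List (Fin n)
  ordering = arrangement element

  ordering-Unique : ∀ σ → Unique (ordering σ)
  ordering-Unique = arrangement-Unique element-injective

  ordering-injective : Injective _≡_ _≡_ ordering
  ordering-injective = arrangement-injective element-injective

  length-ordering : ∀ σ → length (ordering σ) ≡ m
  length-ordering = length-arrangement element

  ∈-ordering⁻ : ∀ σ {v} → v ∈ ordering σ → v Subset.∈ p × v ≢ x × v ≢ y
  ∈-ordering⁻ σ v∈ with j , refl ← ∈-arrangement⁻ element σ v∈ = ∈p-x-y⁻ (enumerate-∈ (p - x - y) (inject≤ j m≤∣p-x-y∣))

[m+n]!≤m!*n!*2^[m+n] : ∀ m n → (m + n) ! ≤ m ! * n ! * 2 ^ (m + n)
[m+n]!≤m!*n!*2^[m+n] zero n = begin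
  n !             ≤⟨ ℕ.m≤m*n (n !) (2 ^ n) {{ℕ.m^n≢0 2 n}} ⟩
  n ! * 2 ^ n     ≡⟨ cong (_* 2 ^ n) (ℕ.*-identityˡ (n !)) ⟨
  1 * n ! * 2 ^ n ∎
  where open ℕ.≤-Reasoning
[m+n]!≤m!*n!*2^[m+n] m@(suc _) zero = begin
  (m + 0) !           ≡⟨ cong _! (ℕ.+-identityʳ m) ⟩
  m !                 ≤⟨ ℕ.m≤m*n (m !) (2 ^ (m + 0)) {{ℕ.m^n≢0 2 (m + 0)}} ⟩
  m ! * 2 ^ (m + 0)   ≡⟨ cong (_* 2 ^ (m + 0)) (ℕ.*-identityʳ (m !)) ⟨
  m ! * 1 * 2 ^ (m + 0) ∎
  where open ℕ.≤-Reasoning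
[m+n]!≤m!*n!*2^[m+n] (suc m) (suc n) = begin
  (suc m + suc n) * (m + suc n) !
    ≡⟨ ℕ.*-distribʳ-+ ((m + suc n) !) (suc m) (suc n) ⟩
  suc m * (m + suc n) ! + suc n * (m + suc n) !
    ≡⟨ cong (λ e → suc m * (m + suc n) ! + suc n * e !) (ℕ.+-suc m n) ⟩
  suc m * (m + suc n) ! + suc n * (suc m + n) !
    ≤⟨ ℕ.+-mono-≤ (ℕ.*-monoʳ-≤ (suc m) ([m+n]!≤m!*n!*2^[m+n] m (suc n)))
                  (ℕ.*-monoʳ-≤ (suc n) ([m+n]!≤m!*n!*2^[m+n] (suc m) n)) ⟩
  suc m * (m ! * suc n ! * 2 ^ (m + suc n)) + suc n * (suc m ! * n ! * 2 ^ (suc m + n))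
    ≡⟨ cong (λ e → suc m * (m ! * suc n ! * 2 ^ e) + suc n * (suc m ! * n ! * 2 ^ (suc m + n))) (ℕ.+-suc m n) ⟩
  suc m * (m ! * suc n ! * 2 ^ (suc m + n)) + suc n * (suc m ! * n ! * 2 ^ (suc m + n))
    ≡⟨ regroup (suc m) (suc n) (m !) (n !) (2 ^ (m + n)) ⟩
  suc m ! * suc n ! * (2 * 2 ^ (suc m + n))
    ≡⟨ cong (λ e → suc m ! * suc n ! * (2 * 2 ^ e)) (ℕ.+-suc m n) ⟨
  suc m ! * suc n ! * 2 ^ (suc m + suc n)
    ∎
  where
  open ℕ.≤-Reasoning
  regroup : ∀ a b x y z → a * (x * (b * y) * (2 * z)) + b * ((a * x) * y * (2 * z)) ≡ (a * x) * (b * y) * (2 * (2 * z))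
  regroup = solve-∀

m!*2^n≤n!*2^m : ∀ {m n} → 1 ≤ m → m ≤ n → m ! * 2 ^ n ≤ n ! * 2 ^ m
m!*2^n≤n!*2^m {m} {n} 1≤m m≤n = go (ℕ.≤⇒≤′ m≤n)
  where
  go : ∀ {n} → m ≤′ n → m ! * 2 ^ n ≤ n ! * 2 ^ m
  go ≤′-refl = ℕ.≤-refl
  go {suc n} (≤′-step m≤′n) = begin
    m ! * (2 * 2 ^ n)       ≡⟨ swap (m !) (2 ^ n) ⟩
    2 * (m ! * 2 ^ n)       ≤⟨ ℕ.*-mono-≤ 2≤1+n (go m≤′n) ⟩
    suc n * (n ! * 2 ^ m)   ≡⟨ ℕ.*-assoc (suc n) (n !) (2 ^ m) ⟨
    suc n ! * 2 ^ m         ∎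
    where
    open ℕ.≤-Reasoning
    2≤1+n : 2 ≤ suc n
    2≤1+n = s≤s (ℕ.≤-trans 1≤m (ℕ.≤′⇒≤ m≤′n))
    swap : ∀ x y → x * (2 * y) ≡ 2 * (x * y)
    swap = solve-∀

m!*n!≤N⇒k!≤N*2^k : ∀ {k m n N} → 1 ≤ k → k ≤ m + n → m ! * n ! ≤ N → k ! ≤ N * 2 ^ k
m!*n!≤N⇒k!≤N*2^k {k} {m} {n} {N} 1≤k k≤m+n m!*n!≤N =
  ℕ.*-cancelʳ-≤ (k !) (N * 2 ^ k) (2 ^ (m + n)) {{ℕ.m^n≢0 2 (m + n)}} (begin
    k ! * 2 ^ (m + n)               ≤⟨ m!*2^n≤n!*2^m 1≤k k≤m+n ⟩
    (m + n) ! * 2 ^ k               ≤⟨ ℕ.*-monoˡ-≤ (2 ^ k) ([m+n]!≤m!*n!*2^[m+n] m n) ⟩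
    m ! * n ! * 2 ^ (m + n) * 2 ^ k ≤⟨ ℕ.*-monoˡ-≤ (2 ^ k) (ℕ.*-monoˡ-≤ (2 ^ (m + n)) m!*n!≤N) ⟩
    N * 2 ^ (m + n) * 2 ^ k         ≡⟨ swap N (2 ^ (m + n)) (2 ^ k) ⟩
    N * 2 ^ k * 2 ^ (m + n)         ∎)
  where
  open ℕ.≤-Reasoning
  swap : ∀ x y z → x * y * z ≡ x * z * y
  swap = solve-∀

l∸4≤[a∸2]+[b∸2] : ∀ {l a b} → l ≤ 2 * a ∸ 1 → l ≤ 2 * b ∸ 1 → l ∸ 4 ≤ (a ∸ 2) + (b ∸ 2)
l∸4≤[a∸2]+[b∸2] {l} {a} {b} l≤2a∸1 l≤2b∸1 = begin
  l ∸ 4             ≤⟨ ℕ.∸-monoˡ-≤ 4 l≤a+b ⟩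
  a + b ∸ 4         ≤⟨ ℕ.m≤n+o⇒m∸n≤o (a + b) 4 a+b≤4+[a∸2]+[b∸2] ⟩
  (a ∸ 2) + (b ∸ 2) ∎
  where
  open ℕ.≤-Reasoning
  l≤a+b : l ≤ a + b
  l≤a+b = ℕ.*-cancelˡ-≤ 2 (begin
    2 * l                     ≡⟨ cong (_+_ l) (ℕ.+-identityʳ l) ⟩
    l + l                     ≤⟨ ℕ.+-mono-≤ l≤2a∸1 l≤2b∸1 ⟩
    (2 * a ∸ 1) + (2 * b ∸ 1) ≤⟨ ℕ.+-mono-≤ (ℕ.m∸n≤m (2 * a) 1) (ℕ.m∸n≤m (2 * b) 1) ⟩
    2 * a + 2 * b             ≡⟨ ℕ.*-distribˡ-+ 2 a b ⟨
    2 * (a + b)               ∎)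
  a+b≤4+[a∸2]+[b∸2] : a + b ≤ 4 + ((a ∸ 2) + (b ∸ 2))
  a+b≤4+[a∸2]+[b∸2] = ℕ.≤-trans (ℕ.+-mono-≤ (ℕ.m≤n+m∸n a 2) (ℕ.m≤n+m∸n b 2)) (ℕ.≤-reflexive (regroup (a ∸ 2) (b ∸ 2)))
    where
    regroup : ∀ x y → (2 + x) + (2 + y) ≡ 4 + (x + y)
    regroup = solve-∀

toℚᵘ-/ : ∀ i d → toℚᵘ (i / suc d) ℚᵘ.≃ mkℚᵘ i d
toℚᵘ-/ i d = ℚ.toℚᵘ-fromℚᵘ (mkℚᵘ i d)

/-*-/ : ∀ a b m n .{{_ : NonZero m}} .{{_ : NonZero n}} →
        (+ a / m) ℚ.* (+ b / n) ≡ ((+ (a * b)) / (m * n)) {{ℕ.m*n≢0 m n}}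
/-*-/ a b (suc m) (suc n) = ℚ.toℚᵘ-injective (begin-equality
  toℚᵘ ((+ a / suc m) ℚ.* (+ b / suc n))         ≃⟨ ℚ.toℚᵘ-homo-* (+ a / suc m) (+ b / suc n) ⟩
  toℚᵘ (+ a / suc m) ℚᵘ.* toℚᵘ (+ b / suc n)     ≃⟨ ℚᵘ.*-cong (toℚᵘ-/ (+ a) m) (toℚᵘ-/ (+ b) n) ⟩
  mkℚᵘ (+ a ℤ.* + b) (n + m * suc n)             ≡⟨ cong (λ i → mkℚᵘ i (n + m * suc n)) (ℤ.pos-* a b) ⟨
  mkℚᵘ (+ (a * b)) (n + m * suc n)               ≃⟨ toℚᵘ-/ (+ (a * b)) (n + m * suc n) ⟨
  toℚᵘ ((+ (a * b)) / (suc m * suc n))           ∎)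
  where open ℚᵘ.≤-Reasoning

powℚ-/ : ∀ a m k .{{_ : NonZero m}} → powℚ (+ a / m) k ≡ ((+ (a ^ k)) / (m ^ k)) {{ℕ.m^n≢0 m k}}
powℚ-/ a m zero    = refl
powℚ-/ a m (suc k) {{m≢0}} = trans (cong ((+ a / m) ℚ.*_) (powℚ-/ a m k)) (/-*-/ a (a ^ k) m (m ^ k) {{m≢0}} {{ℕ.m^n≢0 m k}})

/-≤-/ : ∀ a b m n .{{_ : NonZero m}} .{{_ : NonZero n}} → a * n ≤ b * m → (+ a / m) ℚ.≤ (+ b / n)
/-≤-/ a b (suc m) (suc n) an≤bm = ℚ.toℚᵘ-cancel-≤
  (ℚᵘ.≤-respʳ-≃ (ℚᵘ.≃-sym (toℚᵘ-/ (+ b) n)) (ℚᵘ.≤-respˡ-≃ (ℚᵘ.≃-sym (toℚᵘ-/ (+ a) m))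
    (ℚᵘ.*≤* (subst₂ ℤ._≤_ (ℤ.pos-* a (suc n)) (ℤ.pos-* b (suc m)) (ℤ.+≤+ an≤bm)))))

expPartial-nonNeg : ∀ k m → 0ℚ ℚ.≤ expPartial k m
expPartial-nonNeg k zero    = ℚ.≤-refl
expPartial-nonNeg k (suc m) = ℚ.≤-trans (ℚ.≤-reflexive (sym (ℚ.+-identityʳ 0ℚ)))
  (ℚ.+-mono-≤ (expPartial-nonNeg k m) (ℚ.nonNegative⁻¹ _ {{ℚ.normalize-nonNeg (k ^ m) (m !) {{m !≢0}}}}))

term≤expPartial : ∀ k m → ((+ (k ^ m)) / (m !)) {{m !≢0}} ℚ.≤ expPartial k (suc m)
term≤expPartial k m =
  ℚ.≤-trans (ℚ.≤-reflexive (sym (ℚ.+-identityˡ _))) (ℚ.+-monoˡ-≤ _ (expPartial-nonNeg k m))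

≤[·e^]-intro : ∀ {q N k} m → q ℚ.≤ (+ N / 1) ℚ.* expPartial k m → q ≤[ N ·e^ k ]
≤[·e^]-intro {q} m q≤ ε ε>0 = m , ℚ.<-respˡ-≡ (ℚ.+-identityʳ q) (ℚ.+-mono-≤-< q≤ ε>0)

powℚ[a/2]≤[·e^] : ∀ a k N → a ^ k * k ! ≤ N * k ^ k * 2 ^ k → powℚ (+ a / 2) k ≤[ N ·e^ k ]
powℚ[a/2]≤[·e^] a k N a^k*k!≤ = ≤[·e^]-intro {N = N} {k} (suc k) (begin
  powℚ (+ a / 2) k                                   ≡⟨ powℚ-/ a 2 k ⟩
  ((+ (a ^ k)) / (2 ^ k)) {{ℕ.m^n≢0 2 k}}             ≤⟨ /-≤-/ (a ^ k) (N * k ^ k) (2 ^ k) (1 * k !)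
                                                           {{ℕ.m^n≢0 2 k}} {{1*k!≢0}} a^k*[1*k!]≤ ⟩
  ((+ (N * k ^ k)) / (1 * k !)) {{1*k!≢0}}            ≡⟨ /-*-/ N (k ^ k) 1 (k !) {{_}} {{k !≢0}} ⟨
  (+ N / 1) ℚ.* ((+ (k ^ k)) / (k !)) {{k !≢0}}      ≤⟨ ℚ.*-monoˡ-≤-nonNeg (+ N / 1) {{ℚ.normalize-nonNeg N 1}} (term≤expPartial k k) ⟩
  (+ N / 1) ℚ.* expPartial k (suc k)                 ∎)
  where
  open ℚ.≤-Reasoning
  1*k!≢0 : NonZero (1 * k !)
  1*k!≢0 = ℕ.m*n≢0 1 (k !) {{_}} {{k !≢0}}
  a^k*[1*k!]≤ : a ^ k * (1 * k !) ≤ N * k ^ k * 2 ^ k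
  a^k*[1*k!]≤ = subst (λ x → a ^ k * x ≤ N * k ^ k * 2 ^ k) (sym (ℕ.*-identityˡ (k !))) a^k*k!≤

powℚ[[k∸1]/2]≤[·e^] : ∀ k N → k ! ≤ N * 2 ^ k → powℚ (+ (k ∸ 1) / 2) k ≤[ N ·e^ k ]
powℚ[[k∸1]/2]≤[·e^] k N k!≤N*2^k = powℚ[a/2]≤[·e^] (k ∸ 1) k N (begin
  (k ∸ 1) ^ k * k ! ≤⟨ ℕ.*-mono-≤ (ℕ.^-monoˡ-≤ k (ℕ.m∸n≤m k 1)) k!≤N*2^k ⟩
  k ^ k * (N * 2 ^ k) ≡⟨ regroup (k ^ k) N (2 ^ k) ⟩
  N * k ^ k * 2 ^ k ∎)
  where
  open ℕ.≤-Reasoning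
  regroup : ∀ x y z → x * (y * z) ≡ y * x * z
  regroup = solve-∀

module CyclicSequences {n} (F : Graph n) where

  IsCyclicSeq : List (Fin n) → Set
  IsCyclicSeq []       = ⊥
  IsCyclicSeq (x ∷ xs) = Unique (x ∷ xs) × Linked (Edge F) (x ∷ xs ++ [ x ])

  Edge-sym : Symmetric (Edge F)
  Edge-sym {x} {y} Exy = trans (Graph.sym F y x) Exy

  IsCyclicSeq-++-comm : ∀ xs ys → IsCyclicSeq (xs ++ ys) → IsCyclicSeq (ys ++ xs)
  IsCyclicSeq-++-comm []       ys       c = subst IsCyclicSeq (sym (List.++-identityʳ ys)) c
  IsCyclicSeq-++-comm (x ∷ xs) []       c = subst IsCyclicSeq (List.++-identityʳ (x ∷ xs)) c
  IsCyclicSeq-++-comm (x ∷ xs) (y ∷ ys) (unique , closed) = Unique-++-comm (x ∷ xs) unique , closed′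
    where
    x⋯y×y⋯x : Linked (Edge F) ((x ∷ xs) ++ [ y ]) × Linked (Edge F) (y ∷ ys ++ [ x ])
    x⋯y×y⋯x = Linked-++-∷⁻ (x ∷ xs) (subst (Linked (Edge F)) (List.++-assoc (x ∷ xs) (y ∷ ys) [ x ]) closed)

    closed′ : Linked (Edge F) ((y ∷ ys ++ x ∷ xs) ++ [ y ])
    closed′ = subst (Linked (Edge F)) (sym (List.++-assoc (y ∷ ys) (x ∷ xs) [ y ]))
                (Linked-++-∷ (y ∷ ys) (proj₂ x⋯y×y⋯x) (proj₁ x⋯y×y⋯x))

  IsCyclicSeq-reverse : ∀ {x} xs → IsCyclicSeq (x ∷ xs) → IsCyclicSeq (x ∷ reverse xs)
  IsCyclicSeq-reverse {x} xs (unique , closed) =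
    Unique-resp-↭ (↭-prep x (↭-sym (Permutation.↭-reverse xs))) unique ,
    subst (Linked (Edge F)) (reverse-∷-++-[] x xs x) (Linked-reverse Edge-sym closed)

  IsCyclicSeq-rotate : ∀ {x} V j → IsCyclicSeq (x ∷ V) → IsCyclicSeq (rotate j x V)
  IsCyclicSeq-rotate {x} V j c = IsCyclicSeq-++-comm (x ∷ take j V) (drop j V)
    (subst IsCyclicSeq (cong (x ∷_) (sym (List.take++drop≡id j V))) c)

  IsCyclicSeq-oriented : ∀ d {x} V → IsCyclicSeq (x ∷ V) → IsCyclicSeq (x ∷ oriented d V)
  IsCyclicSeq-oriented zero       V c = c
  IsCyclicSeq-oriented (suc zero) V c = IsCyclicSeq-reverse V c

  chainB-Linked : ∀ {xs} → Linked (Edge F) xs → chainB F xs ≡ true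
  chainB-Linked []          = refl
  chainB-Linked [-]         = refl
  chainB-Linked (Exy ∷ Exs) = cong₂ _∧_ Exy (chainB-Linked Exs)

  distinctB-Unique : ∀ {xs} → Unique xs → distinctB F xs ≡ true
  distinctB-Unique []               = refl
  distinctB-Unique {x ∷ xs} unique@(_ ∷ unique′) =
    cong₂ _∧_ (cong Bool.not (no-match xs (Unique.Unique[x∷xs]⇒x∉xs unique))) (distinctB-Unique unique′)
    where
    no-match : ∀ ys → x ∉ ys → any (λ y → does (x Fin.≟ y)) ys ≡ false
    no-match []       _    = refl
    no-match (y ∷ ys) x∉ys with x Fin.≟ y
    ... | yes x≡y = ⊥-elim (x∉ys (here x≡y))
    ... | no  _   = no-match ys (x∉ys ∘ there)

  cyclicSeqB-IsCyclicSeq : ∀ {xs} → IsCyclicSeq xs → cyclicSeqB F xs ≡ true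
  cyclicSeqB-IsCyclicSeq {_ ∷ _} (unique , closed) = cong₂ _∧_ (distinctB-Unique unique) (chainB-Linked closed)

  ∈-allLists : ∀ xs → xs ∈ allLists F (length xs)
  ∈-allLists []       = here refl
  ∈-allLists (x ∷ xs) = ∈-concatMap⁺ (λ v → List.map (_∷ v) (List.allFin n)) (Any.map (λ { refl → ∈-map⁺ (_∷ xs) (∈-allFin x) }) (∈-allLists xs))

  Injective⇒≤cyclicSeqCount : ∀ {m l} (g : Fin m → List (Fin n)) → Injective _≡_ _≡_ g →
                              (∀ i → IsCyclicSeq (g i)) → (∀ i → length (g i) ≡ l) → m ≤ cyclicSeqCount F l
  Injective⇒≤cyclicSeqCount {l = l} g g-inj cyclic length≡ = Injective⇒≤length g g-inj g∈
    where
    g∈ : ∀ i → g i ∈ List.filterᵇ (cyclicSeqB F) (allLists F l)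
    g∈ i = subst (λ k → g i ∈ List.filterᵇ (cyclicSeqB F) (allLists F k)) (length≡ i)
             (∈-filter⁺ (T? ∘ cyclicSeqB F) (∈-allLists (g i)) (subst T (sym (cyclicSeqB-IsCyclicSeq (cyclic i))) tt))

  cyclicSeqCount⇒≤numCycles : ∀ l .{{_ : NonZero l}} K → 2 * l * K ≤ cyclicSeqCount F l → K ≤ numCycles F l
  cyclicSeqCount⇒≤numCycles l@(suc _) K le = begin
    K                             ≡⟨ ℕ.m*n/n≡m K (2 * l) ⟨
    K * (2 * l) ℕ./ (2 * l)       ≡⟨ ℕ./-congˡ (ℕ.*-comm K (2 * l)) ⟩
    2 * l * K ℕ./ (2 * l)         ≤⟨ ℕ./-monoˡ-≤ (2 * l) le ⟩
    cyclicSeqCount F l ℕ./ (2 * l) ∎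
    where open ℕ.≤-Reasoning

module CyclesThroughTwoPaths {n} (F : Graph n) (S T : Subset n) (S#T : ∀ x → x Subset.∈ S → x Subset.∉ T) where
  open CyclicSequences F

  clique-Linked : ∀ {C} → IsClique F C → ∀ {xs} → All (Subset._∈ C) xs → Unique xs → Linked (Edge F) xs
  clique-Linked C-clique []                  _                    = []
  clique-Linked C-clique (_ ∷ [])            _                    = [-]
  clique-Linked C-clique (x∈C ∷ y∈C ∷ xs⊆C) ((x≢y ∷ _) ∷ unique) =
    C-clique _ _ x∈C y∈C x≢y ∷ clique-Linked C-clique (y∈C ∷ xs⊆C) unique

  clique-Linked-between : ∀ {C} → IsClique F C → ∀ {x y xs} → x Subset.∈ C → y Subset.∈ C → x ≢ y →
                          (∀ {v} → v ∈ xs → v Subset.∈ C × v ≢ x × v ≢ y) → Unique xs → Linked (Edge F) (x ∷ xs ++ [ y ])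
  clique-Linked-between C-clique x∈C y∈C x≢y xs⊆C-x-y unique =
    clique-Linked C-clique (x∈C ∷ All.++⁺ (All.tabulate (proj₁ ∘ xs⊆C-x-y)) (y∈C ∷ []))
      (Unique-∷-++-[] x≢y (λ x∈xs → proj₁ (proj₂ (xs⊆C-x-y x∈xs)) refl) (λ y∈xs → proj₂ (proj₂ (xs⊆C-x-y y∈xs)) refl) unique)

  record STPath : Set where
    field
      source target : Fin n
      inner         : List (Fin n)
      source∈S      : source Subset.∈ S
      target∈T      : target Subset.∈ T
      inner∉S∪T     : All (λ v → v Subset.∉ S × v Subset.∉ T) inner
      unique        : Unique (source ∷ inner ++ [ target ])
      walk          : Linked (Edge F) (source ∷ inner ++ [ target ])

    vertices : List (Fin n)
    vertices = source ∷ inner ++ [ target ]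

    target∈vertices : target ∈ vertices
    target∈vertices = there (∈-++⁺ʳ inner (here refl))

    2≤length-vertices : 2 ≤ length vertices
    2≤length-vertices = s≤s (List.length-++-≤ʳ [ target ] {inner})

    ∈vertices∩S⇒source : ∀ {v} → v ∈ vertices → v Subset.∈ S → v ≡ source
    ∈vertices∩S⇒source (here v≡s) _ = v≡s
    ∈vertices∩S⇒source (there v∈) v∈S with ∈-++⁻ inner v∈
    ... | inj₁ v∈inner     = ⊥-elim (proj₁ (All.lookup inner∉S∪T v∈inner) v∈S)
    ... | inj₂ (here refl) = ⊥-elim (S#T _ v∈S target∈T)

    ∈vertices∩T⇒target : ∀ {v} → v ∈ vertices → v Subset.∈ T → v ≡ target
    ∈vertices∩T⇒target (here refl) v∈T = ⊥-elim (S#T _ source∈S v∈T)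
    ∈vertices∩T⇒target (there v∈)  v∈T with ∈-++⁻ inner v∈
    ... | inj₁ v∈inner     = ⊥-elim (proj₂ (All.lookup inner∉S∪T v∈inner) v∈T)
    ... | inj₂ (here v≡t)  = v≡t

  open STPath

  STPath-fromVec : ∀ {k} (P : Vec (Fin n) (suc k)) → k ≤ 2 → IsSTPath F S T P →
                   Σ STPath λ p → vertices p ≡ toList P
  STPath-fromVec (x ∷ []) _ (_ , x∈S , x∈T , _) = ⊥-elim (S#T x x∈S x∈T)
  STPath-fromVec P@(x ∷ y ∷ []) _ ((P-injective , P-edges) , x∈S , y∈T , _) =
    record
      { source = x ; target = y ; inner = [] ; source∈S = x∈S ; target∈T = y∈T ; inner∉S∪T = []
      ; unique = toList-Unique P (P-injective _ _) ; walk = toList-Linked P P-edges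
      } , refl
  STPath-fromVec P@(x ∷ y ∷ z ∷ []) _ ((P-injective , P-edges) , x∈S , z∈T , interior) =
    record
      { source = x ; target = z ; inner = [ y ] ; source∈S = x∈S ; target∈T = z∈T
      ; inner∉S∪T = interior (suc zero) (λ ()) (λ ()) ∷ []
      ; unique = toList-Unique P (P-injective _ _) ; walk = toList-Linked P P-edges
      } , refl
  STPath-fromVec (_ ∷ _ ∷ _ ∷ _ ∷ _) (s≤s (s≤s ())) _

  module _ (S-clique : IsClique F S) (T-clique : IsClique F T)
           (p q : STPath) (p#q : Disjoint (vertices p) (vertices q))
           {rS rT} (rS≤ : rS ≤ ∣ S - source p - source q ∣) (rT≤ : rT ≤ ∣ T - target p - target q ∣) where

    open STPath p using () renaming (source to s₁; target to t₁; inner to I₁)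
    open STPath q using () renaming (source to s₂; target to t₂; inner to I₂)

    module X = Orderings T t₁ t₂ rT≤
    module Y = Orderings S s₁ s₂ rS≤

    s₁≢s₂ : s₁ ≢ s₂
    s₁≢s₂ s₁≡s₂ = p#q (here refl , here s₁≡s₂)

    t₁≢t₂ : t₁ ≢ t₂
    t₁≢t₂ t₁≡t₂ = p#q (target∈vertices p , subst (_∈ vertices q) (sym t₁≡t₂) (target∈vertices q))

    tour : Fin (rS !) → Fin (rT !) → List (Fin n)
    tour σ τ = (I₁ ++ [ t₁ ]) ++ X.ordering τ ++ reverse (vertices q) ++ Y.ordering σ

    tour-Unique : ∀ σ τ → Unique (s₁ ∷ tour σ τ)
    tour-Unique σ τ =
      Unique.++⁺ (unique p)
        (Unique.++⁺ (X.ordering-Unique τ)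
          (Unique.++⁺ (Unique-reverse (unique q)) (Y.ordering-Unique σ) q#Y)
          X#qY)
        p#XqY
      where
      q#Y : Disjoint (reverse (vertices q)) (Y.ordering σ)
      q#Y (v∈q , v∈Y) with v∈S , _ , v≢s₂ ← Y.∈-ordering⁻ σ v∈Y = v≢s₂ (∈vertices∩S⇒source q (Any.reverse⁻ v∈q) v∈S)

      X#qY : Disjoint (X.ordering τ) (reverse (vertices q) ++ Y.ordering σ)
      X#qY (v∈X , v∈qY) with v∈T , _ , v≢t₂ ← X.∈-ordering⁻ τ v∈X | ∈-++⁻ (reverse (vertices q)) v∈qY
      ... | inj₁ v∈q = v≢t₂ (∈vertices∩T⇒target q (Any.reverse⁻ v∈q) v∈T)
      ... | inj₂ v∈Y = S#T _ (proj₁ (Y.∈-ordering⁻ σ v∈Y)) v∈T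

      p#XqY : Disjoint (vertices p) (X.ordering τ ++ reverse (vertices q) ++ Y.ordering σ)
      p#XqY (v∈p , v∈XqY) with ∈-++⁻ (X.ordering τ) v∈XqY
      ... | inj₁ v∈X with v∈T , v≢t₁ , _ ← X.∈-ordering⁻ τ v∈X = v≢t₁ (∈vertices∩T⇒target p v∈p v∈T)
      ... | inj₂ v∈qY with ∈-++⁻ (reverse (vertices q)) v∈qY
      ...   | inj₁ v∈q = p#q (v∈p , Any.reverse⁻ v∈q)
      ...   | inj₂ v∈Y with v∈S , v≢s₁ , _ ← Y.∈-ordering⁻ σ v∈Y = v≢s₁ (∈vertices∩S⇒source p v∈p v∈S)

    tour-closed : ∀ σ τ → Linked (Edge F) (s₁ ∷ tour σ τ ++ [ s₁ ])
    tour-closed σ τ = subst (Linked (Edge F)) (cong (s₁ ∷_) (sym segments))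
      (Linked-++-∷ (s₁ ∷ I₁) (walk p) (Linked-++-∷ (t₁ ∷ X.ordering τ) T-segment (Linked-++-∷ (t₂ ∷ reverse I₂) q-backwards S-segment)))
      where
      T-segment : Linked (Edge F) (t₁ ∷ X.ordering τ ++ [ t₂ ])
      T-segment = clique-Linked-between T-clique (target∈T p) (target∈T q) t₁≢t₂ (X.∈-ordering⁻ τ) (X.ordering-Unique τ)

      q-backwards : Linked (Edge F) (t₂ ∷ reverse I₂ ++ [ s₂ ])
      q-backwards = subst (Linked (Edge F)) (reverse-∷-++-[] s₂ I₂ t₂) (Linked-reverse Edge-sym (walk q))

      S-segment : Linked (Edge F) (s₂ ∷ Y.ordering σ ++ [ s₁ ])
      S-segment = clique-Linked-between S-clique (source∈S q) (source∈S p) (s₁≢s₂ ∘ sym)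
        (λ v∈Y → let v∈S , v≢s₁ , v≢s₂ = Y.∈-ordering⁻ σ v∈Y in v∈S , v≢s₂ , v≢s₁) (Y.ordering-Unique σ)

      segments : tour σ τ ++ [ s₁ ] ≡ I₁ ++ t₁ ∷ X.ordering τ ++ t₂ ∷ reverse I₂ ++ s₂ ∷ Y.ordering σ ++ [ s₁ ]
      segments = begin
        ((I₁ ++ [ t₁ ]) ++ X.ordering τ ++ reverse (vertices q) ++ Y.ordering σ) ++ [ s₁ ]
          ≡⟨ ++-assoc₄ (I₁ ++ [ t₁ ]) (X.ordering τ) (reverse (vertices q)) (Y.ordering σ) [ s₁ ] ⟩
        (I₁ ++ [ t₁ ]) ++ X.ordering τ ++ reverse (vertices q) ++ Y.ordering σ ++ [ s₁ ]
          ≡⟨ cong (λ zs → (I₁ ++ [ t₁ ]) ++ X.ordering τ ++ zs ++ Y.ordering σ ++ [ s₁ ]) (reverse-∷-++-[] s₂ I₂ t₂) ⟩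
        (I₁ ++ [ t₁ ]) ++ X.ordering τ ++ ((t₂ ∷ reverse I₂) ++ [ s₂ ]) ++ Y.ordering σ ++ [ s₁ ]
          ≡⟨ cong (λ zs → (I₁ ++ [ t₁ ]) ++ X.ordering τ ++ zs) (List.∷ʳ-++ (t₂ ∷ reverse I₂) s₂ _) ⟩
        (I₁ ++ [ t₁ ]) ++ X.ordering τ ++ t₂ ∷ reverse I₂ ++ s₂ ∷ Y.ordering σ ++ [ s₁ ]
          ≡⟨ List.∷ʳ-++ I₁ t₁ _ ⟩
        I₁ ++ t₁ ∷ X.ordering τ ++ t₂ ∷ reverse I₂ ++ s₂ ∷ Y.ordering σ ++ [ s₁ ]
          ∎
        where open ≡-Reasoning

    tour-IsCyclicSeq : ∀ σ τ → IsCyclicSeq (s₁ ∷ tour σ τ)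
    tour-IsCyclicSeq σ τ = tour-Unique σ τ , tour-closed σ τ

    tour-starts-outside-S : ∀ σ τ → StartsWith (¬_ ∘ (Subset._∈ S)) (tour σ τ)
    tour-starts-outside-S σ τ with w , ws , eq , w∉S ← head-++-∷ (All.map proj₁ (inner∉S∪T p)) (λ t₁∈S → S#T t₁ t₁∈S (target∈T p))
      = w , ws , trans (List.∷ʳ-++ I₁ t₁ _) eq , w∉S

    tour-ends-in-S : ∀ σ τ → StartsWith (Subset._∈ S) (reverse (tour σ τ))
    tour-ends-in-S σ τ
      with w , ws , eq , w∈S ← head-++-∷ (All.tabulate (λ v∈ → proj₁ (Y.∈-ordering⁻ σ (Any.reverse⁻ v∈)))) (source∈S q)
      = w , ws , trans (reverse-++-reverse-++ (I₁ ++ [ t₁ ]) (X.ordering τ) (vertices q) (Y.ordering σ)) eq , w∈S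

    tour-injective : ∀ {σ τ σ′ τ′} → tour σ τ ≡ tour σ′ τ′ → σ ≡ σ′ × τ ≡ τ′
    tour-injective {σ} {τ} {σ′} {τ′} eq
      with X≡ , rest≡ ← ++-injective-length (X.ordering τ) (X.ordering τ′) (trans (X.length-ordering τ) (sym (X.length-ordering τ′)))
                                             (List.++-cancelˡ (I₁ ++ [ t₁ ]) _ _ eq)
      = Y.ordering-injective (List.++-cancelˡ (reverse (vertices q)) _ _ rest≡) , X.ordering-injective X≡

    cycleLength : ℕ
    cycleLength = length (vertices p) + length (vertices q) + (rS + rT)

    length-tour : ∀ σ τ → suc (length (tour σ τ)) ≡ cycleLength
    length-tour σ τ = begin
      length (vertices p ++ X.ordering τ ++ reverse (vertices q) ++ Y.ordering σ)
        ≡⟨ List.length-++ (vertices p) ⟩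
      length (vertices p) + length (X.ordering τ ++ reverse (vertices q) ++ Y.ordering σ)
        ≡⟨ cong (_+_ (length (vertices p))) (List.length-++ (X.ordering τ)) ⟩
      length (vertices p) + (length (X.ordering τ) + length (reverse (vertices q) ++ Y.ordering σ))
        ≡⟨ cong (λ m → length (vertices p) + (length (X.ordering τ) + m)) (List.length-++ (reverse (vertices q))) ⟩
      length (vertices p) + (length (X.ordering τ) + (length (reverse (vertices q)) + length (Y.ordering σ)))
        ≡⟨ cong₂ (λ x y → length (vertices p) + (x + y)) (X.length-ordering τ)
                 (cong₂ _+_ (List.length-reverse (vertices q)) (Y.length-ordering σ)) ⟩
      length (vertices p) + (rT + (length (vertices q) + rS))
        ≡⟨ rearrange (length (vertices p)) rT (length (vertices q)) rS ⟩
      cycleLength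
        ∎
      where
      open ≡-Reasoning
      rearrange : ∀ a b c d → a + (b + (c + d)) ≡ a + c + (d + b)
      rearrange = solve-∀

    cyclicSequence : Fin 2 × Fin cycleLength → Fin (rS !) × Fin (rT !) → List (Fin n)
    cyclicSequence (d , j) (σ , τ) = rotate (toℕ j) s₁ (oriented d (tour σ τ))

    cyclicSequence-IsCyclicSeq : ∀ dj στ → IsCyclicSeq (cyclicSequence dj στ)
    cyclicSequence-IsCyclicSeq (d , j) (σ , τ) =
      IsCyclicSeq-rotate (oriented d (tour σ τ)) (toℕ j) (IsCyclicSeq-oriented d (tour σ τ) (tour-IsCyclicSeq σ τ))

    length-cyclicSequence : ∀ dj στ → length (cyclicSequence dj στ) ≡ cycleLength
    length-cyclicSequence (d , j) (σ , τ) =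
      trans (length-rotate (toℕ j) s₁ (oriented d (tour σ τ)))
            (trans (cong suc (length-oriented d (tour σ τ))) (length-tour σ τ))

    toℕ≤length-tour : ∀ d (j : Fin cycleLength) σ τ → toℕ j ≤ length (oriented d (tour σ τ))
    toℕ≤length-tour d j σ τ = subst (toℕ j ≤_) (sym (length-oriented d (tour σ τ)))
      (s≤s⁻¹ (subst (toℕ j <_) (sym (length-tour σ τ)) (Fin.toℕ<n j)))

    s₁∉tour : ∀ σ τ → s₁ ∉ tour σ τ
    s₁∉tour σ τ = Unique.Unique[x∷xs]⇒x∉xs (tour-Unique σ τ)

    -- s₁ occurs once, which fixes the rotation; a tour leaves s₁ outside S and comes back from
    -- inside S, which fixes the direction.
    cyclicSequence-injective : ∀ {dj στ dj′ στ′} → cyclicSequence dj στ ≡ cyclicSequence dj′ στ′ → dj ≡ dj′ × στ ≡ στ′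
    cyclicSequence-injective {d , j} {σ , τ} {d′ , j′} {σ′ , τ′} eq
      with j≡j′ , tours≡ ← rotate-injective (toℕ j) (toℕ j′)
                             (∉-oriented d (s₁∉tour σ τ)) (∉-oriented d′ (s₁∉tour σ′ τ′))
                             (toℕ≤length-tour d j σ τ) (toℕ≤length-tour d′ j′ σ′ τ′) eq
      with d≡d′ , tour≡ ← oriented-injective d d′ (tour-starts-outside-S σ τ) (tour-starts-outside-S σ′ τ′)
                                              (tour-ends-in-S σ τ) (tour-ends-in-S σ′ τ′) tours≡
      with σ≡σ′ , τ≡τ′ ← tour-injective tour≡
      = cong₂ _,_ d≡d′ (Fin.toℕ-injective j≡j′) , cong₂ _,_ σ≡σ′ τ≡τ′

    factorials≤numCycles : rS ! * rT ! ≤ numCycles F cycleLength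
    factorials≤numCycles = cyclicSeqCount⇒≤numCycles cycleLength (rS ! * rT !)
      (Injective⇒≤cyclicSeqCount {l = cycleLength} (flatten sequence)
        (flatten-injective (λ eq → let dj≡ , στ≡ = cyclicSequence-injective eq in
                                   remQuot-injective cycleLength dj≡ , remQuot-injective (rT !) στ≡))
        (flatten-∀ {P = IsCyclicSeq} {f = sequence}
                   (λ x y → cyclicSequence-IsCyclicSeq (remQuot cycleLength x) (remQuot (rT !) y)))
        (flatten-∀ {P = λ xs → length xs ≡ cycleLength} {f = sequence}
                   (λ x y → length-cyclicSequence (remQuot cycleLength x) (remQuot (rT !) y))))
      where
      sequence : Fin (2 * cycleLength) → Fin (rS ! * rT !) → List (Fin n)
      sequence x y = cyclicSequence (remQuot cycleLength x) (remQuot (rT !) y)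

  [l∸6]!≤numCycles*2^[l∸6] : IsClique F S → IsClique F T → (p q : STPath) → Disjoint (vertices p) (vertices q) →
                             length (vertices p) ≤ 3 → length (vertices q) ≤ 3 →
                             ∀ {l} → 7 ≤ l → l ≤ 2 * ∣ S ∣ ∸ 1 → l ≤ 2 * ∣ T ∣ ∸ 1 → (l ∸ 6) ! ≤ numCycles F l * 2 ^ (l ∸ 6)
  [l∸6]!≤numCycles*2^[l∸6] S-clique T-clique p q p#q ∣p∣≤3 ∣q∣≤3 {l} 7≤l l≤2∣S∣∸1 l≤2∣T∣∸1 =
    m!*n!≤N⇒k!≤N*2^k {m = rS} {rT} (ℕ.m<n⇒0<n∸m 7≤l) l∸6≤rS+rT rS!*rT!≤numCycles
    where
    -- S takes as many of the r free places as it can; the rest fit into T by r≤[∣S∣∸2]+[∣T∣∸2].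
    base r rS rT : ℕ
    base = length (vertices p) + length (vertices q)
    r    = l ∸ base
    rS   = (∣ S ∣ ∸ 2) ⊓ r
    rT   = r ∸ (∣ S ∣ ∸ 2)

    base≤6 : base ≤ 6
    base≤6 = ℕ.+-mono-≤ ∣p∣≤3 ∣q∣≤3

    r≤[∣S∣∸2]+[∣T∣∸2] : r ≤ (∣ S ∣ ∸ 2) + (∣ T ∣ ∸ 2)
    r≤[∣S∣∸2]+[∣T∣∸2] = ℕ.≤-trans (ℕ.∸-monoʳ-≤ l (ℕ.+-mono-≤ (2≤length-vertices p) (2≤length-vertices q)))
                                  (l∸4≤[a∸2]+[b∸2] {a = ∣ S ∣} {∣ T ∣} l≤2∣S∣∸1 l≤2∣T∣∸1)

    rS+rT≡r : rS + rT ≡ r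
    rS+rT≡r = ℕ.m⊓n+n∸m≡n (∣ S ∣ ∸ 2) r

    l∸6≤rS+rT : l ∸ 6 ≤ rS + rT
    l∸6≤rS+rT = subst (l ∸ 6 ≤_) (sym rS+rT≡r) (ℕ.∸-monoʳ-≤ l base≤6)

    base+r≡l : base + r ≡ l
    base+r≡l = ℕ.m+[n∸m]≡n (ℕ.≤-trans base≤6 (ℕ.≤-trans (ℕ.n≤1+n 6) 7≤l))

    rS!*rT!≤numCycles : rS ! * rT ! ≤ numCycles F l
    rS!*rT!≤numCycles = subst (λ m → rS ! * rT ! ≤ numCycles F m) (trans (cong (_+_ base) rS+rT≡r) base+r≡l)
      (factorials≤numCycles S-clique T-clique p q p#q
        (ℕ.≤-trans (ℕ.m⊓n≤m (∣ S ∣ ∸ 2) r) (∣p∣∸2≤∣p-x-y∣ S _ _))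
        (ℕ.≤-trans (ℕ.m≤n+o⇒m∸n≤o r (∣ S ∣ ∸ 2) r≤[∣S∣∸2]+[∣T∣∸2]) (∣p∣∸2≤∣p-x-y∣ T _ _)))

claim2p10 : ∀ {n} (F : Graph n) (S T : Subset n)
    → IsClique F S → IsClique F T → (∀ x → x Subset.∈ S → x Subset.∉ T)
    → ∀ {k₁ k₂} (P₁ : Vec (Fin n) (suc k₁)) (P₂ : Vec (Fin n) (suc k₂))
    → k₁ ≤ 2 → k₂ ≤ 2
    → IsSTPath F S T P₁ → IsSTPath F S T P₂
    → (∀ i j → lookup P₁ i ≢ lookup P₂ j)
    → ∀ (l : ℕ) → 7 ≤ l → l ≤ 2 * ∣ S ∣ ∸ 1 → l ≤ 2 * ∣ T ∣ ∸ 1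
    → powℚ ((+ (l ∸ 7)) / 2) (l ∸ 6) ≤[ numCycles F l ·e^ (l ∸ 6) ]
claim2p10 {n} F S T S-clique T-clique S#T P₁ P₂ k₁≤2 k₂≤2 P₁-STPath P₂-STPath P₁#P₂ l 7≤l l≤2∣S∣∸1 l≤2∣T∣∸1 =
  subst (λ a → powℚ (+ a / 2) (l ∸ 6) ≤[ numCycles F l ·e^ (l ∸ 6) ]) (ℕ.∸-+-assoc l 6 1)
    (powℚ[[k∸1]/2]≤[·e^] (l ∸ 6) (numCycles F l)
      ([l∸6]!≤numCycles*2^[l∸6] S-clique T-clique p q p#q (length≤3 P₁ k₁≤2 p≡P₁) (length≤3 P₂ k₂≤2 q≡P₂)
                                7≤l l≤2∣S∣∸1 l≤2∣T∣∸1))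
  where
  open CyclesThroughTwoPaths F S T S#T
  open STPath using (vertices)

  p q : STPath
  p = proj₁ (STPath-fromVec P₁ k₁≤2 P₁-STPath)
  q = proj₁ (STPath-fromVec P₂ k₂≤2 P₂-STPath)

  p≡P₁ : vertices p ≡ toList P₁
  p≡P₁ = proj₂ (STPath-fromVec P₁ k₁≤2 P₁-STPath)

  q≡P₂ : vertices q ≡ toList P₂
  q≡P₂ = proj₂ (STPath-fromVec P₂ k₂≤2 P₂-STPath)

  p#q : Disjoint (vertices p) (vertices q)
  p#q = subst₂ Disjoint (sym p≡P₁) (sym q≡P₂) (toList-Disjoint P₁ P₂ P₁#P₂)

  length≤3 : ∀ {k} (P : Vec (Fin n) (suc k)) → k ≤ 2 → ∀ {xs} → xs ≡ toList P → length xs ≤ 3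
  length≤3 P k≤2 refl = ℕ.≤-trans (ℕ.≤-reflexive (Vec.length-toList P)) (s≤s k≤2)
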